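{- Let $G=(V,E)$ be any $n$-vertex graph with maximum degree $\Delta$. Consider the following algorithm: initialize empty color classes $C_1,\dots,C_{\Delta+1}$; pick a uniformly random permutation $\pi$ of $V$; for each $v\in V$ in the order of $\pi$, repeat: sample $c\in[\Delta+1]$ uniformly at random and, for every $u\in C_c$, query whether $(u,v)\in E$; if some such query answers yes, resample $c$ and repeat; otherwise color $v$ with $c$, add $v$ to $C_c$, and proceed. For $v\in V$ let $X_v$ be the number of pair queries $(u,v)$ made by the algorithm while coloring $v$, and let $\deg^{<}_\pi(v)$ be the number of neighbors of $v$ that appear before $v$ in $\pi$ (i.e., are colored before $v$). Then for any vertex $v\in V$ and any choice of the permutation $\pi$, \[ \mathbb{E}[X_v\mid\pi]\le\frac{n}{\Delta+1-\deg^{<}_\pi(v)}. \]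
   Context: $[t]=\{1,\dots,t\}$. -}

module Defs where

open import Data.Bool using (Bool; true; false; if_then_else_; _∧_)
open import Data.Nat as ℕ using (ℕ; zero; suc; _<ᵇ_)
open import Data.Integer using (+_)
open import Data.Rational using (ℚ; _/_; _+_; _*_; 0ℚ; 1ℚ)
open import Data.Fin using (Fin; toℕ; _≟_)
open import Data.Fin.Permutation using (Permutation′; _⟨$⟩ʳ_; _⟨$⟩ˡ_)
open import Data.List using (List; []; _∷_; map; concatMap; allFin; foldr)
open import Data.Maybe using (Maybe; just; nothing)
open import Data.Product using (_×_; _,_)
open import Relation.Nullary.Decidable using (⌊_⌋)

-- Simple graphs on vertex set Fin n, given by a Boolean adjacency
-- relation (symmetry / irreflexivity are hypotheses of the theorem).

Adjacency : ℕ → Set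
Adjacency n = Fin n → Fin n → Bool

countᵇ : {A : Set} → (A → Bool) → List A → ℕ
countᵇ p []       = 0
countᵇ p (x ∷ xs) = if p x then suc (countᵇ p xs) else countᵇ p xs

anyᵇ : {A : Set} → (A → Bool) → List A → Bool
anyᵇ p []       = false
anyᵇ p (x ∷ xs) = if p x then true else anyᵇ p xs

deg : {n : ℕ} → Adjacency n → Fin n → ℕ
deg {n} E v = countᵇ (E v) (allFin n)

-- position of a vertex in the order given by π: the vertex processed at
-- step i is  π ⟨$⟩ʳ i, so the position of u is  π ⟨$⟩ˡ u.
pos : {n : ℕ} → Permutation′ n → Fin n → ℕ
pos π u = toℕ (π ⟨$⟩ˡ u)

degBefore : {n : ℕ} → Adjacency n → Permutation′ n → Fin n → ℕ
degBefore {n} E π v = countᵇ (λ u → E v u ∧ (pos π u <ᵇ pos π v)) (allFin n)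

-- Finite (sub)probability distributions with rational weights.

Dist : Set → Set
Dist A = List (ℚ × A)

return : {A : Set} → A → Dist A
return a = (1ℚ , a) ∷ []

_>>=_ : {A B : Set} → Dist A → (A → Dist B) → Dist B
d >>= f = concatMap (λ { (w , a) → map (λ { (w' , b) → (w * w' , b) }) (f a) }) d

expectation : Dist ℕ → ℚ
expectation = foldr (λ { (w , x) acc → w * (+ x / 1) + acc }) 0ℚ

-- The algorithm, truncated with a fuel parameter bounding the number of
-- colour samples per vertex (branches exceeding the fuel are dropped,
-- so the resulting distribution is a sub-probability distribution).

-- Colouring state: colour assigned so far (nothing = not yet coloured);
-- the colour class C_c is { u | col u ≡ just c }.
Colouring : ℕ → ℕ → Set
Colouring n Δ = Fin n → Maybe (Fin (suc Δ))

inClass : {n Δ : ℕ} → Colouring n Δ → Fin (suc Δ) → Fin n → Bool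
inClass col c u with col u
... | nothing = false
... | just c' = ⌊ c' ≟ c ⌋

-- Returns the chosen colour and the total number of queries made for v.
tryColour : {n : ℕ} (Δ : ℕ) → Adjacency n → ℕ → Colouring n Δ → Fin n → ℕ →
            Dist (Fin (suc Δ) × ℕ)
tryColour Δ E zero       col v acc = []
tryColour {n} Δ E (suc fuel) col v acc =
  concatMap
    (λ c → let q   = countᵇ (inClass col c) (allFin n)
               bad = anyᵇ (λ u → inClass col c u ∧ E u v) (allFin n)
           in map (λ { (w , r) → ((+ 1 / suc Δ) * w , r) })
                  (if bad then tryColour Δ E fuel col v (acc ℕ.+ q)
                          else return (c , acc ℕ.+ q)))
    (allFin (suc Δ))

update : {n Δ : ℕ} → Colouring n Δ → Fin n → Fin (suc Δ) → Colouring n Δ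
update col u c w = if ⌊ w ≟ u ⌋ then just c else col w

-- Process the vertices in the given order, tracking X_v (the number of
-- queries made while colouring the target vertex v).
process : {n : ℕ} (Δ : ℕ) → Adjacency n → ℕ → Fin n →
          List (Fin n) → Colouring n Δ → ℕ → Dist ℕ
process Δ E fuel v []       col xv = return xv
process Δ E fuel v (u ∷ us) col xv =
  tryColour Δ E fuel col u 0 >>= λ { (c , q) →
  process Δ E fuel v us (update col u c) (if ⌊ u ≟ v ⌋ then q else xv) }

-- Distribution of X_v given π, with at most `fuel` samples per vertex.
-- As fuel → ∞ the truncated expectation increases to E[X_v | π].
Xdist : {n : ℕ} (Δ : ℕ) → Adjacency n → Permutation′ n → Fin n → ℕ → Dist ℕ
Xdist {n} Δ E π v fuel =
  process Δ E fuel v (map (π ⟨$⟩ʳ_) (allFin n)) (λ _ → nothing) 0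

truncatedExpectedQueries : {n : ℕ} (Δ : ℕ) → Adjacency n → Permutation′ n →
                           Fin n → ℕ → ℚ
truncatedExpectedQueries Δ E π v fuel = expectation (Xdist Δ E π v fuel)

{-# OPTIONS --safe #-}
module Submission where

-- While v is being coloured, the colour classes C_c partition the vertices coloured so far, and all
-- of these precede v in π. A sample c costs |C_c| queries and is rejected only if C_c contains a
-- neighbour of v; distinct rejected classes contain distinct earlier neighbours, so at most
-- d = deg^<_π(v) of the Δ + 1 colours are rejected. With Q = Σ_c |C_c| ≤ n, the expected cost X of
-- the sampling loop therefore satisfies X ≤ (Q + d X)/(Δ + 1), i.e. X ≤ Q/(Δ + 1 − d); for the
-- fuel-truncated loop this is an induction on the fuel. Vertices processed after v leave X_v
-- unchanged, and each sampling loop has total mass at most 1, so the bound survives the whole run.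

open import Data.Nat using (ℕ)
open import Data.Fin using (Fin)
open import Data.Fin.Permutation using (Permutation′)
open import Defs

module Rationals where

  open import Data.Nat as ℕ using (zero; suc)
  import Data.Nat.Properties as ℕ
  open import Data.Integer as ℤ using (+_)
  import Data.Integer.Properties as ℤ
  open import Data.Rational
  open import Data.Rational.Properties
  import Data.Rational.Unnormalised as ℚᵘ
  import Data.Rational.Unnormalised.Properties as ℚᵘ
  open import Function using (_∘_)
  open import Relation.Binary.PropositionalEquality
  open import Algebra.Bundles using (Ring)
  import Algebra.Properties.Semiring.Sum ℕ.+-*-semiring as ℕΣ
  open import Algebra.Properties.Semiring.Sum (Ring.semiring +-*-ring) public

  fromℕ : ℕ → ℚ
  fromℕ n = + n / 1

  toℚᵘ-/ : ∀ k m → toℚᵘ (+ k / suc m) ℚᵘ.≃ ℚᵘ.mkℚᵘ (+ k) m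
  toℚᵘ-/ k m = toℚᵘ-fromℚᵘ (ℚᵘ.mkℚᵘ (+ k) m)

  fromℕ-+ : ∀ a b → fromℕ (a ℕ.+ b) ≡ fromℕ a + fromℕ b
  fromℕ-+ a b = toℚᵘ-injective (begin
    toℚᵘ (fromℕ (a ℕ.+ b))                ≈⟨ toℚᵘ-/ (a ℕ.+ b) 0 ⟩
    ℚᵘ.mkℚᵘ (+ (a ℕ.+ b)) 0               ≈⟨ ℚᵘ.*≡* (cong (ℤ._* + 1) +[a+b]≡a*1+b*1) ⟩
    ℚᵘ.mkℚᵘ (+ a) 0 ℚᵘ.+ ℚᵘ.mkℚᵘ (+ b) 0  ≈⟨ ℚᵘ.+-cong (toℚᵘ-/ a 0) (toℚᵘ-/ b 0) ⟨
    toℚᵘ (fromℕ a) ℚᵘ.+ toℚᵘ (fromℕ b)    ≈⟨ toℚᵘ-homo-+ (fromℕ a) (fromℕ b) ⟨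
    toℚᵘ (fromℕ a + fromℕ b)              ∎)
    where
    open ℚᵘ.≃-Reasoning
    +[a+b]≡a*1+b*1 : + (a ℕ.+ b) ≡ + a ℤ.* + 1 ℤ.+ + b ℤ.* + 1
    +[a+b]≡a*1+b*1 = trans (ℤ.pos-+ a b) (sym (cong₂ ℤ._+_ (ℤ.*-identityʳ (+ a)) (ℤ.*-identityʳ (+ b))))

  m*[k/m]≡k : ∀ m k → fromℕ (suc m) * (+ k / suc m) ≡ fromℕ k
  m*[k/m]≡k m k = toℚᵘ-injective (begin
    toℚᵘ (fromℕ (suc m) * (+ k / suc m))          ≈⟨ toℚᵘ-homo-* (fromℕ (suc m)) (+ k / suc m) ⟩
    toℚᵘ (fromℕ (suc m)) ℚᵘ.* toℚᵘ (+ k / suc m)  ≈⟨ ℚᵘ.*-cong (toℚᵘ-/ (suc m) 0) (toℚᵘ-/ k m) ⟩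
    ℚᵘ.mkℚᵘ (+ suc m) 0 ℚᵘ.* ℚᵘ.mkℚᵘ (+ k) m      ≈⟨ ℚᵘ.*≡* cross-multiplied ⟩
    ℚᵘ.mkℚᵘ (+ k) 0                               ≈⟨ toℚᵘ-/ k 0 ⟨
    toℚᵘ (fromℕ k)                                ∎)
    where
    open ℚᵘ.≃-Reasoning
    cross-multiplied : (+ suc m ℤ.* + k) ℤ.* + 1 ≡ + k ℤ.* + (1 ℕ.* suc m)
    cross-multiplied = trans (ℤ.*-identityʳ _)
      (trans (ℤ.*-comm (+ suc m) (+ k)) (cong (λ d → + k ℤ.* + d) (sym (ℕ.*-identityˡ (suc m)))))

  /-nonNeg : ∀ k m → 0ℚ ≤ + k / suc m
  /-nonNeg k m = nonNegative⁻¹ _ {{normalize-nonNeg k (suc m)}}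

  fromℕ-nonNeg : ∀ k → 0ℚ ≤ fromℕ k
  fromℕ-nonNeg k = /-nonNeg k 0

  fromℕ-mono-≤ : ∀ {a b} → a ℕ.≤ b → fromℕ a ≤ fromℕ b
  fromℕ-mono-≤ {a} {b} a≤b = begin
    fromℕ a                      ≡⟨ +-identityʳ (fromℕ a) ⟨
    fromℕ a + 0ℚ                 ≤⟨ +-monoʳ-≤ (fromℕ a) (fromℕ-nonNeg (b ℕ.∸ a)) ⟩
    fromℕ a + fromℕ (b ℕ.∸ a)    ≡⟨ fromℕ-+ a (b ℕ.∸ a) ⟨
    fromℕ (a ℕ.+ (b ℕ.∸ a))      ≡⟨ cong fromℕ (ℕ.m+[n∸m]≡n a≤b) ⟩
    fromℕ b                      ∎
    where open ≤-Reasoning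

  /-monoˡ-≤ : ∀ {a b} m → a ℕ.≤ b → + a / suc m ≤ + b / suc m
  /-monoˡ-≤ {a} {b} m a≤b = *-cancelˡ-≤-pos (fromℕ (suc m)) {{normalize-pos (suc m) 1}}
    (subst₂ _≤_ (sym (m*[k/m]≡k m a)) (sym (m*[k/m]≡k m b)) (fromℕ-mono-≤ a≤b))

  ∑-const : ∀ m x → ∑[ i < m ] x ≡ fromℕ m * x
  ∑-const zero    x = sym (*-zeroˡ x)
  ∑-const (suc m) x = begin
    x + ∑[ i < m ] x       ≡⟨ cong (_+_ x) (∑-const m x) ⟩
    x + fromℕ m * x        ≡⟨ cong (_+ fromℕ m * x) (*-identityˡ x) ⟨
    1ℚ * x + fromℕ m * x   ≡⟨ *-distribʳ-+ x 1ℚ (fromℕ m) ⟨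
    (1ℚ + fromℕ m) * x     ≡⟨ cong (_* x) (fromℕ-+ 1 m) ⟨
    fromℕ (suc m) * x      ∎
    where open ≡-Reasoning

  fromℕ-∑ : ∀ {m} (f : Fin m → ℕ) → fromℕ (ℕΣ.sum f) ≡ ∑[ i < m ] fromℕ (f i)
  fromℕ-∑ {zero}  f = refl
  fromℕ-∑ {suc m} f =
    trans (fromℕ-+ (f Fin.zero) _) (cong (_+_ (fromℕ (f Fin.zero))) (fromℕ-∑ (f ∘ Fin.suc)))

  ∑-mono-≤ : ∀ {m} {f g : Fin m → ℚ} → (∀ i → f i ≤ g i) → ∑[ i < m ] f i ≤ ∑[ i < m ] g i
  ∑-mono-≤ {zero}  f≤g = ≤-refl
  ∑-mono-≤ {suc m} f≤g = +-mono-≤ (f≤g Fin.zero) (∑-mono-≤ (f≤g ∘ Fin.suc))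

module Distributions where

  open Rationals
  open import Data.Nat using (zero; suc)
  open import Data.Rational
  open import Data.Rational.Properties
  open import Data.List using ([]; _∷_; _++_; map; concatMap; tabulate)
  open import Data.List.Relation.Unary.All using (All; []; _∷_)
  open import Data.Product using (_×_; _,_; proj₁)
  open import Function using (_∘_)
  open import Relation.Binary.PropositionalEquality

  private
    variable
      A B : Set

  𝔼 : (A → ℚ) → Dist A → ℚ
  𝔼 F []            = 0ℚ
  𝔼 F ((w , a) ∷ d) = w * F a + 𝔼 F d

  mass : Dist A → ℚ
  mass = 𝔼 (λ _ → 1ℚ)

  NonNegWeights : Dist A → Set
  NonNegWeights = All (λ p → 0ℚ ≤ proj₁ p)

  record SubProbability (d : Dist A) : Set where
    field
      nonNegWeights : NonNegWeights d
      mass≤1 : mass d ≤ 1ℚ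

  scale : ℚ → ℚ × A → ℚ × A
  scale r (w , a) = (r * w , a)

  scale-nonNeg : ∀ {r} {d : Dist A} → 0ℚ ≤ r → NonNegWeights d → NonNegWeights (map (scale r) d)
  scale-nonNeg         0≤r []          = []
  scale-nonNeg {r = r} 0≤r (0≤w ∷ 0≤d) =
    nonNegative⁻¹ _ {{nonNeg*nonNeg⇒nonNeg r {{nonNegative 0≤r}} _ {{nonNegative 0≤w}}}}
      ∷ scale-nonNeg 0≤r 0≤d

  expectation≡𝔼 : ∀ d → expectation d ≡ 𝔼 fromℕ d
  expectation≡𝔼 []            = refl
  expectation≡𝔼 ((w , x) ∷ d) = cong (_+_ (w * fromℕ x)) (expectation≡𝔼 d)

  𝔼-return : ∀ (F : A → ℚ) a → 𝔼 F (return a) ≡ F a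
  𝔼-return F a = trans (+-identityʳ _) (*-identityˡ _)

  𝔼-++ : ∀ (F : A → ℚ) d e → 𝔼 F (d ++ e) ≡ 𝔼 F d + 𝔼 F e
  𝔼-++ F []            e = sym (+-identityˡ _)
  𝔼-++ F ((w , a) ∷ d) e = trans (cong (_+_ (w * F a)) (𝔼-++ F d e)) (sym (+-assoc (w * F a) _ _))

  𝔼-scale : ∀ (F : A → ℚ) r d → 𝔼 F (map (scale r) d) ≡ r * 𝔼 F d
  𝔼-scale F r []            = sym (*-zeroʳ r)
  𝔼-scale F r ((w , a) ∷ d) = begin
    r * w * F a + 𝔼 F (map (scale r) d)  ≡⟨ cong₂ _+_ (*-assoc r w (F a)) (𝔼-scale F r d) ⟩
    r * (w * F a) + r * 𝔼 F d            ≡⟨ *-distribˡ-+ r (w * F a) (𝔼 F d) ⟨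
    r * (w * F a + 𝔼 F d)                ∎
    where open ≡-Reasoning

  𝔼-concatMap : ∀ (F : A → ℚ) {m} (h : B → Dist A) (f : Fin m → B) →
                𝔼 F (concatMap h (tabulate f)) ≡ ∑[ i < m ] 𝔼 F (h (f i))
  𝔼-concatMap F {zero}  h f = refl
  𝔼-concatMap F {suc m} h f = trans (𝔼-++ F (h (f Fin.zero)) _)
    (cong (_+_ (𝔼 F (h (f Fin.zero)))) (𝔼-concatMap F h (f ∘ Fin.suc)))

  𝔼->>= : ∀ (F : B → ℚ) (d : Dist A) (k : A → Dist B) → 𝔼 F (d >>= k) ≡ 𝔼 (𝔼 F ∘ k) d
  𝔼->>= F []            k = refl
  𝔼->>= F ((w , a) ∷ d) k = trans (𝔼-++ F (map (scale w) (k a)) (d >>= k))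
    (cong₂ _+_ (𝔼-scale F w (k a)) (𝔼->>= F d k))

  𝔼-mono : ∀ {F G : A → ℚ} {d} → NonNegWeights d → (∀ a → F a ≤ G a) → 𝔼 F d ≤ 𝔼 G d
  𝔼-mono                        []         F≤G = ≤-refl
  𝔼-mono {d = (w , a) ∷ d} (0≤w ∷ 0≤d) F≤G =
    +-mono-≤ (*-monoˡ-≤-nonNeg w {{nonNegative 0≤w}} (F≤G a)) (𝔼-mono 0≤d F≤G)

  𝔼-const : ∀ c (d : Dist A) → 𝔼 (λ _ → c) d ≡ mass d * c
  𝔼-const c []            = sym (*-zeroˡ c)
  𝔼-const c ((w , a) ∷ d) = begin
    w * c + 𝔼 (λ _ → c) d    ≡⟨ cong₂ _+_ (cong (_* c) (sym (*-identityʳ w))) (𝔼-const c d) ⟩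
    w * 1ℚ * c + mass d * c  ≡⟨ *-distribʳ-+ c (w * 1ℚ) (mass d) ⟨
    (w * 1ℚ + mass d) * c    ∎
    where open ≡-Reasoning

  >>=-mono : ∀ {F : B → ℚ} {G : A → ℚ} {d k} → NonNegWeights d →
             (∀ a → 𝔼 F (k a) ≤ G a) → 𝔼 F (d >>= k) ≤ 𝔼 G d
  >>=-mono {F = F} {d = d} {k} 0≤d k≤G = subst (_≤ _) (sym (𝔼->>= F d k)) (𝔼-mono 0≤d k≤G)

  >>=-bounded : ∀ {F : B → ℚ} {d : Dist A} {k} c → SubProbability d → 0ℚ ≤ c →
                (∀ a → 𝔼 F (k a) ≤ c) → 𝔼 F (d >>= k) ≤ c
  >>=-bounded {F = F} {d} {k} c sub 0≤c k≤c = begin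
    𝔼 F (d >>= k)         ≤⟨ >>=-mono (SubProbability.nonNegWeights sub) k≤c ⟩
    𝔼 (λ _ → c) d         ≡⟨ 𝔼-const c d ⟩
    mass d * c            ≤⟨ *-monoʳ-≤-nonNeg c {{nonNegative 0≤c}} (SubProbability.mass≤1 sub) ⟩
    1ℚ * c                ≡⟨ *-identityˡ c ⟩
    c                     ∎
    where open ≤-Reasoning

module Counting where

  open import Data.Bool using (Bool; true; false; if_then_else_; _∧_; T)
  open import Data.Nat using (zero; suc; _+_; _*_; _≤_; z≤n; s≤s)
  open import Data.Nat.Properties using (+-identityʳ; ≤-refl; +-mono-≤; +-*-semiring)
  open import Data.Empty using (⊥-elim)
  open import Data.Fin using (zero; suc; _≟_)
  open import Data.Fin.Properties using (suc-injective)
  open import Data.List using ([]; _∷_; tabulate)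
  open import Data.Unit using (tt)
  open import Function using (_∘_)
  open import Relation.Nullary.Decidable using (⌊_⌋; ⌊⌋-map′)
  open import Relation.Binary.PropositionalEquality
  open import Algebra.Properties.Semiring.Sum +-*-semiring public

  private
    variable
      A : Set

  𝟙 : Bool → ℕ
  𝟙 b = if b then 1 else 0

  𝟙-∧ : ∀ a b → 𝟙 (a ∧ b) ≡ 𝟙 a * 𝟙 b
  𝟙-∧ false b = refl
  𝟙-∧ true  b = sym (+-identityʳ (𝟙 b))

  𝟙-mono : ∀ {a b} → (T a → T b) → 𝟙 a ≤ 𝟙 b
  𝟙-mono {false}         _   = z≤n
  𝟙-mono {true}  {true}  _   = ≤-refl
  𝟙-mono {true}  {false} a⇒b = ⊥-elim (a⇒b tt)

  𝟙≤1 : ∀ b → 𝟙 b ≤ 1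
  𝟙≤1 false = z≤n
  𝟙≤1 true  = ≤-refl

  countᵇ-∷ : ∀ (p : A → Bool) x xs → countᵇ p (x ∷ xs) ≡ 𝟙 (p x) + countᵇ p xs
  countᵇ-∷ p x xs with p x
  ... | true  = refl
  ... | false = refl

  countᵇ-tabulate : ∀ (p : A → Bool) {m} (f : Fin m → A) →
                    countᵇ p (tabulate f) ≡ ∑[ i < m ] 𝟙 (p (f i))
  countᵇ-tabulate p {zero}  f = refl
  countᵇ-tabulate p {suc m} f =
    trans (countᵇ-∷ p (f zero) (tabulate (f ∘ suc)))
          (cong (𝟙 (p (f zero)) +_) (countᵇ-tabulate p (f ∘ suc)))

  countᵇ-mono : ∀ {p q : A → Bool} → (∀ x → T (p x) → T (q x)) → ∀ xs → countᵇ p xs ≤ countᵇ q xs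
  countᵇ-mono         p⇒q []       = z≤n
  countᵇ-mono {p = p} {q} p⇒q (x ∷ xs) = subst₂ _≤_ (sym (countᵇ-∷ p x xs)) (sym (countᵇ-∷ q x xs))
    (+-mono-≤ (𝟙-mono (p⇒q x)) (countᵇ-mono p⇒q xs))

  𝟙-anyᵇ≤countᵇ : ∀ (p : A → Bool) xs → 𝟙 (anyᵇ p xs) ≤ countᵇ p xs
  𝟙-anyᵇ≤countᵇ p []       = z≤n
  𝟙-anyᵇ≤countᵇ p (x ∷ xs) with p x
  ... | true  = s≤s z≤n
  ... | false = 𝟙-anyᵇ≤countᵇ p xs

  ∑-mono-≤ : ∀ {m} {f g : Fin m → ℕ} → (∀ i → f i ≤ g i) → ∑[ i < m ] f i ≤ ∑[ i < m ] g i
  ∑-mono-≤ {zero}  f≤g = z≤n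
  ∑-mono-≤ {suc m} f≤g = +-mono-≤ (f≤g zero) (∑-mono-≤ (f≤g ∘ suc))

  ∑-1 : ∀ m → ∑[ i < m ] 1 ≡ m
  ∑-1 zero    = refl
  ∑-1 (suc m) = cong suc (∑-1 m)

  ∑-𝟙-≟ : ∀ {m} (i : Fin m) → ∑[ j < m ] 𝟙 ⌊ i ≟ j ⌋ ≡ 1
  ∑-𝟙-≟ {suc m} zero    = cong suc (sum-replicate-zero m)
  ∑-𝟙-≟ {suc m} (suc i) =
    trans (sum-cong-≗ (λ j → cong 𝟙 (⌊⌋-map′ (cong suc) suc-injective (i ≟ j)))) (∑-𝟙-≟ i)

module ColourClasses {n Δ : ℕ} (col : Colouring n Δ) where

  open Counting
  open import Data.Bool using (Bool; _∧_; T)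
  open import Data.Bool.Properties using (T-∧)
  open import Data.Nat using (suc; _≤_; _*_)
  open import Data.Nat.Properties using (module ≤-Reasoning)
  open import Data.List using (allFin)
  open import Data.Maybe using (is-just; just; nothing)
  open import Data.Product using (_,_)
  open import Function using (id; Equivalence)
  open import Relation.Binary.PropositionalEquality

  classSize : Fin (suc Δ) → ℕ
  classSize c = countᵇ (inClass col c) (allFin n)

  ∑-inClass : ∀ u → ∑[ c < suc Δ ] 𝟙 (inClass col c u) ≡ 𝟙 (is-just (col u))
  ∑-inClass u with col u
  ... | nothing = sum-replicate-zero (suc Δ)
  ... | just c′ = ∑-𝟙-≟ c′

  totalClassSize : ℕ
  totalClassSize = ∑[ c < suc Δ ] classSize c

  totalClassSize≤n : totalClassSize ≤ n
  totalClassSize≤n = begin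
    ∑[ c < suc Δ ] classSize c
      ≡⟨ sum-cong-≗ (λ c → countᵇ-tabulate (inClass col c) id) ⟩
    ∑[ c < suc Δ ] ∑[ u < n ] 𝟙 (inClass col c u)   ≡⟨ ∑-comm (λ c u → 𝟙 (inClass col c u)) ⟩
    ∑[ u < n ] ∑[ c < suc Δ ] 𝟙 (inClass col c u)   ≡⟨ sum-cong-≗ ∑-inClass ⟩
    ∑[ u < n ] 𝟙 (is-just (col u))                  ≤⟨ ∑-mono-≤ (λ u → 𝟙≤1 (is-just (col u))) ⟩
    ∑[ u < n ] 1                                    ≡⟨ ∑-1 n ⟩
    n                                               ∎
    where open ≤-Reasoning

  module _ (E : Adjacency n) (v : Fin n) where

    conflict : Fin (suc Δ) → Bool
    conflict c = anyᵇ (λ u → inClass col c u ∧ E u v) (allFin n)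

    conflicts : ℕ
    conflicts = countᵇ conflict (allFin (suc Δ))

    module _ (E-sym : ∀ u w → E u w ≡ E w u) (P : Fin n → Bool)
             (coloured⇒P : ∀ u → T (is-just (col u)) → T (P u)) where

      ∑-inClass∧adjacent≤ : ∀ u → ∑[ c < suc Δ ] 𝟙 (inClass col c u ∧ E u v) ≤ 𝟙 (E v u ∧ P u)
      ∑-inClass∧adjacent≤ u = begin
        ∑[ c < suc Δ ] 𝟙 (inClass col c u ∧ E u v)
          ≡⟨ sum-cong-≗ (λ c → 𝟙-∧ (inClass col c u) (E u v)) ⟩
        ∑[ c < suc Δ ] (𝟙 (inClass col c u) * 𝟙 (E u v))
          ≡⟨ *-distribʳ-sum (𝟙 (E u v)) (λ c → 𝟙 (inClass col c u)) ⟨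
        (∑[ c < suc Δ ] 𝟙 (inClass col c u)) * 𝟙 (E u v)   ≡⟨ cong (_* 𝟙 (E u v)) (∑-inClass u) ⟩
        𝟙 (is-just (col u)) * 𝟙 (E u v)                     ≡⟨ 𝟙-∧ (is-just (col u)) (E u v) ⟨
        𝟙 (is-just (col u) ∧ E u v)                         ≤⟨ 𝟙-mono coloured-neighbour⇒P ⟩
        𝟙 (E v u ∧ P u)                                     ∎
        where
        open ≤-Reasoning
        coloured-neighbour⇒P : T (is-just (col u) ∧ E u v) → T (E v u ∧ P u)
        coloured-neighbour⇒P t with Equivalence.to T-∧ t
        ... | coloured , adjacent =
          Equivalence.from T-∧ (subst T (E-sym u v) adjacent , coloured⇒P u coloured)

      conflicts≤ : conflicts ≤ countᵇ (λ u → E v u ∧ P u) (allFin n)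
      conflicts≤ = begin
        conflicts                                               ≡⟨ countᵇ-tabulate conflict id ⟩
        ∑[ c < suc Δ ] 𝟙 (conflict c)
          ≤⟨ ∑-mono-≤ (λ c → 𝟙-anyᵇ≤countᵇ (λ u → inClass col c u ∧ E u v) (allFin n)) ⟩
        ∑[ c < suc Δ ] countᵇ (λ u → inClass col c u ∧ E u v) (allFin n)
          ≡⟨ sum-cong-≗ (λ c → countᵇ-tabulate (λ u → inClass col c u ∧ E u v) id) ⟩
        ∑[ c < suc Δ ] ∑[ u < n ] 𝟙 (inClass col c u ∧ E u v)
          ≡⟨ ∑-comm (λ c u → 𝟙 (inClass col c u ∧ E u v)) ⟩
        ∑[ u < n ] ∑[ c < suc Δ ] 𝟙 (inClass col c u ∧ E u v)
          ≤⟨ ∑-mono-≤ ∑-inClass∧adjacent≤ ⟩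
        ∑[ u < n ] 𝟙 (E v u ∧ P u)
          ≡⟨ countᵇ-tabulate (λ u → E v u ∧ P u) id ⟨
        countᵇ (λ u → E v u ∧ P u) (allFin n)
          ∎
        where open ≤-Reasoning

module ColourSampling {n : ℕ} (Δ : ℕ) (E : Adjacency n) (col : Colouring n Δ) (v : Fin n) where

  open Rationals
  open Distributions
  open Counting using (𝟙; countᵇ-tabulate)
  open ColourClasses col
  open import Data.Bool using (Bool; true; false; if_then_else_)
  open import Data.Nat as ℕ using (suc; zero)
  import Data.Nat.Properties as ℕ
  open import Data.Integer using (+_)
  open import Data.Rational hiding (_/_)
  open import Data.Rational using (_/_)
  open import Data.Rational.Properties
  open import Data.List using (map)
  open import Data.List.Relation.Unary.All as All using ([])
  import Data.List.Relation.Unary.All.Properties as All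
  open import Data.Product using (_×_; _,_; proj₂)
  open import Function using (_∘_; id)
  open import Relation.Binary.PropositionalEquality

  uniform : ℚ
  uniform = + 1 / suc Δ

  attempt : ℕ → ℕ → Fin (suc Δ) → Bool → Dist (Fin (suc Δ) × ℕ)
  attempt k acc c b = if b then tryColour Δ E k col v (acc ℕ.+ classSize c)
                           else return (c , acc ℕ.+ classSize c)

  𝔼-tryColour-suc : ∀ (F : Fin (suc Δ) × ℕ → ℚ) k acc → 𝔼 F (tryColour Δ E (suc k) col v acc) ≡
                    uniform * ∑[ c < suc Δ ] 𝔼 F (attempt k acc c (conflict E v c))
  𝔼-tryColour-suc F k acc = begin
    𝔼 F (tryColour Δ E (suc k) col v acc)
      ≡⟨ 𝔼-concatMap F (λ c → map (scale uniform) (attempt k acc c (conflict E v c))) id ⟩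
    ∑[ c < suc Δ ] 𝔼 F (map (scale uniform) (attempt k acc c (conflict E v c)))
      ≡⟨ sum-cong-≗ (λ c → 𝔼-scale F uniform (attempt k acc c (conflict E v c))) ⟩
    ∑[ c < suc Δ ] (uniform * 𝔼 F (attempt k acc c (conflict E v c)))
      ≡⟨ *-distribˡ-sum uniform (λ c → 𝔼 F (attempt k acc c (conflict E v c))) ⟨
    uniform * ∑[ c < suc Δ ] 𝔼 F (attempt k acc c (conflict E v c))
      ∎
    where open ≡-Reasoning

  uniform-nonNeg : 0ℚ ≤ uniform
  uniform-nonNeg = /-nonNeg 1 Δ

  uniform*[[1+Δ]*x]≡x : ∀ x → uniform * (fromℕ (suc Δ) * x) ≡ x
  uniform*[[1+Δ]*x]≡x x = begin
    uniform * (fromℕ (suc Δ) * x)  ≡⟨ *-assoc uniform (fromℕ (suc Δ)) x ⟨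
    uniform * fromℕ (suc Δ) * x    ≡⟨ cong (_* x) (*-comm uniform (fromℕ (suc Δ))) ⟩
    fromℕ (suc Δ) * uniform * x    ≡⟨ cong (_* x) (m*[k/m]≡k Δ 1) ⟩
    1ℚ * x                         ≡⟨ *-identityˡ x ⟩
    x                              ∎
    where open ≡-Reasoning

  tryColour-nonNeg : ∀ k acc → NonNegWeights (tryColour Δ E k col v acc)
  tryColour-nonNeg zero    acc = []
  tryColour-nonNeg (suc k) acc =
    All.concat⁺ (All.map⁺ (All.tabulate⁺ λ c →
      scale-nonNeg uniform-nonNeg (attempt-nonNeg c (conflict E v c))))
    where
    attempt-nonNeg : ∀ c b → NonNegWeights (attempt k acc c b)
    attempt-nonNeg c true  = tryColour-nonNeg k (acc ℕ.+ classSize c)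
    attempt-nonNeg c false = nonNegative⁻¹ 1ℚ All.∷ []

  tryColour-mass≤1 : ∀ k acc → mass (tryColour Δ E k col v acc) ≤ 1ℚ
  tryColour-mass≤1 zero    acc = nonNegative⁻¹ 1ℚ
  tryColour-mass≤1 (suc k) acc = begin
    mass (tryColour Δ E (suc k) col v acc)
      ≡⟨ 𝔼-tryColour-suc _ k acc ⟩
    uniform * ∑[ c < suc Δ ] mass (attempt k acc c (conflict E v c))
      ≤⟨ *-monoˡ-≤-nonNeg uniform {{nonNegative uniform-nonNeg}}
           (∑-mono-≤ (λ c → attempt-mass≤1 c (conflict E v c))) ⟩
    uniform * ∑[ c < suc Δ ] 1ℚ      ≡⟨ cong (uniform *_) (∑-const (suc Δ) 1ℚ) ⟩
    uniform * (fromℕ (suc Δ) * 1ℚ)   ≡⟨ uniform*[[1+Δ]*x]≡x 1ℚ ⟩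
    1ℚ                               ∎
    where
    open ≤-Reasoning
    attempt-mass≤1 : ∀ c b → mass (attempt k acc c b) ≤ 1ℚ
    attempt-mass≤1 c true  = tryColour-mass≤1 k (acc ℕ.+ classSize c)
    attempt-mass≤1 c false = ≤-reflexive (𝔼-return (λ _ → 1ℚ) (c , acc ℕ.+ classSize c))

  tryColour-subProbability : ∀ k acc → SubProbability (tryColour Δ E k col v acc)
  tryColour-subProbability k acc = record
    { nonNegWeights = tryColour-nonNeg k acc
    ; mass≤1        = tryColour-mass≤1 k acc
    }

  queries : Fin (suc Δ) × ℕ → ℚ
  queries = fromℕ ∘ proj₂

  module _ (m : ℕ) where

    queryBound : ℚ
    queryBound = + totalClassSize / suc m

    queryBound-nonNeg : 0ℚ ≤ queryBound
    queryBound-nonNeg = /-nonNeg totalClassSize m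

    classes+conflicts≤ : conflicts E v ℕ.+ suc m ℕ.≤ suc Δ →
                         fromℕ totalClassSize + fromℕ (conflicts E v) * queryBound ≤
                         fromℕ (suc Δ) * queryBound
    classes+conflicts≤ few-conflicts = begin
      fromℕ totalClassSize + fromℕ B * queryBound
        ≡⟨ cong (_+ fromℕ B * queryBound) (m*[k/m]≡k m totalClassSize) ⟨
      fromℕ (suc m) * queryBound + fromℕ B * queryBound
        ≡⟨ *-distribʳ-+ queryBound (fromℕ (suc m)) (fromℕ B) ⟨
      (fromℕ (suc m) + fromℕ B) * queryBound
        ≡⟨ cong (_* queryBound) (fromℕ-+ (suc m) B) ⟨
      fromℕ (suc m ℕ.+ B) * queryBound
        ≤⟨ *-monoʳ-≤-nonNeg queryBound {{nonNegative queryBound-nonNeg}}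
             (fromℕ-mono-≤ (subst (ℕ._≤ suc Δ) (ℕ.+-comm B (suc m)) few-conflicts)) ⟩
      fromℕ (suc Δ) * queryBound
        ∎
      where
      open ≤-Reasoning
      B = conflicts E v

    ∑-attempt-bounds : ∀ a →
      ∑[ c < suc Δ ] (a + (fromℕ (classSize c) + fromℕ (𝟙 (conflict E v c)) * queryBound)) ≡
      fromℕ (suc Δ) * a + (fromℕ totalClassSize + fromℕ (conflicts E v) * queryBound)
    ∑-attempt-bounds a = begin
      ∑[ c < suc Δ ] (a + (q c + b c * queryBound))
        ≡⟨ ∑-distrib-+ (λ _ → a) (λ c → q c + b c * queryBound) ⟩
      ∑[ c < suc Δ ] a + ∑[ c < suc Δ ] (q c + b c * queryBound)
        ≡⟨ cong₂ _+_ (∑-const (suc Δ) a) (∑-distrib-+ q (λ c → b c * queryBound)) ⟩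
      fromℕ (suc Δ) * a + (∑[ c < suc Δ ] q c + ∑[ c < suc Δ ] (b c * queryBound))
        ≡⟨ cong (λ s → fromℕ (suc Δ) * a + (∑[ c < suc Δ ] q c + s)) (*-distribʳ-sum queryBound b) ⟨
      fromℕ (suc Δ) * a + (∑[ c < suc Δ ] q c + (∑[ c < suc Δ ] b c) * queryBound)
        ≡⟨ cong₂ (λ s t → fromℕ (suc Δ) * a + (s + t * queryBound)) (fromℕ-∑ classSize) fromℕ-conflicts ⟨
      fromℕ (suc Δ) * a + (fromℕ totalClassSize + fromℕ (conflicts E v) * queryBound)
        ∎
      where
      open ≡-Reasoning
      q b : Fin (suc Δ) → ℚ
      q c = fromℕ (classSize c)
      b c = fromℕ (𝟙 (conflict E v c))
      fromℕ-conflicts : fromℕ (conflicts E v) ≡ ∑[ c < suc Δ ] b c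
      fromℕ-conflicts =
        trans (cong fromℕ (countᵇ-tabulate (conflict E v) id)) (fromℕ-∑ (𝟙 ∘ conflict E v))

    attempt-queries≤ : ∀ k → (∀ acc → 𝔼 queries (tryColour Δ E k col v acc) ≤ fromℕ acc + queryBound) →
                       ∀ acc c b → 𝔼 queries (attempt k acc c b) ≤
                                   fromℕ acc + (fromℕ (classSize c) + fromℕ (𝟙 b) * queryBound)
    attempt-queries≤ k tryColour-k≤ acc c true  = begin
      𝔼 queries (tryColour Δ E k col v (acc ℕ.+ q))  ≤⟨ tryColour-k≤ (acc ℕ.+ q) ⟩
      fromℕ (acc ℕ.+ q) + queryBound                 ≡⟨ cong (_+ queryBound) (fromℕ-+ acc q) ⟩
      fromℕ acc + fromℕ q + queryBound               ≡⟨ +-assoc (fromℕ acc) (fromℕ q) queryBound ⟩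
      fromℕ acc + (fromℕ q + queryBound)
        ≡⟨ cong (λ s → fromℕ acc + (fromℕ q + s)) (*-identityˡ queryBound) ⟨
      fromℕ acc + (fromℕ q + 1ℚ * queryBound)        ∎
      where
      open ≤-Reasoning
      q = classSize c
    attempt-queries≤ k tryColour-k≤ acc c false = ≤-reflexive (begin
      𝔼 queries (return (c , acc ℕ.+ q))             ≡⟨ 𝔼-return queries (c , acc ℕ.+ q) ⟩
      fromℕ (acc ℕ.+ q)                              ≡⟨ fromℕ-+ acc q ⟩
      fromℕ acc + fromℕ q                            ≡⟨ cong (_+_ (fromℕ acc)) (+-identityʳ (fromℕ q)) ⟨
      fromℕ acc + (fromℕ q + 0ℚ)
        ≡⟨ cong (λ s → fromℕ acc + (fromℕ q + s)) (*-zeroˡ queryBound) ⟨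
      fromℕ acc + (fromℕ q + 0ℚ * queryBound)        ∎)
      where
      open ≡-Reasoning
      q = classSize c

    𝔼-queries≤ : conflicts E v ℕ.+ suc m ℕ.≤ suc Δ →
                 ∀ k acc → 𝔼 queries (tryColour Δ E k col v acc) ≤ fromℕ acc + queryBound
    𝔼-queries≤ few-conflicts zero    acc = +-mono-≤ (fromℕ-nonNeg acc) queryBound-nonNeg
    𝔼-queries≤ few-conflicts (suc k) acc = begin
      𝔼 queries (tryColour Δ E (suc k) col v acc)
        ≡⟨ 𝔼-tryColour-suc queries k acc ⟩
      uniform * ∑[ c < suc Δ ] 𝔼 queries (attempt k acc c (conflict E v c))
        ≤⟨ *-monoˡ-≤-nonNeg uniform {{nonNegative uniform-nonNeg}} (∑-mono-≤ λ c →
             attempt-queries≤ k (𝔼-queries≤ few-conflicts k) acc c (conflict E v c)) ⟩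
      uniform * ∑[ c < suc Δ ] (a + (fromℕ (classSize c) + fromℕ (𝟙 (conflict E v c)) * queryBound))
        ≡⟨ cong (uniform *_) (∑-attempt-bounds a) ⟩
      uniform * (D * a + (fromℕ totalClassSize + fromℕ (conflicts E v) * queryBound))
        ≤⟨ *-monoˡ-≤-nonNeg uniform {{nonNegative uniform-nonNeg}}
             (+-monoʳ-≤ (D * a) (classes+conflicts≤ few-conflicts)) ⟩
      uniform * (D * a + D * queryBound)
        ≡⟨ cong (uniform *_) (*-distribˡ-+ D a queryBound) ⟨
      uniform * (D * (a + queryBound))
        ≡⟨ uniform*[[1+Δ]*x]≡x (a + queryBound) ⟩
      a + queryBound
        ∎
      where
      open ≤-Reasoning
      a = fromℕ acc
      D = fromℕ (suc Δ)

module Schedule {n : ℕ} (π : Permutation′ n) where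

  open Counting using (countᵇ-mono)
  open import Data.Bool.Properties using (T-∧)
  open import Data.Nat as ℕ using (_≤_)
  open import Data.Fin using (toℕ)
  open import Data.Fin.Permutation using (_⟨$⟩ʳ_; inverseˡ)
  open import Data.List using (map; allFin)
  open import Data.List.Relation.Unary.AllPairs using (AllPairs)
  import Data.List.Relation.Unary.AllPairs.Properties as AllPairs
  open import Data.Product using (proj₁)
  open import Function using (_on_; _∘_; Equivalence)
  open import Relation.Binary.PropositionalEquality

  _≺_ : Fin n → Fin n → Set
  _≺_ = ℕ._<_ on pos π

  pos-⟨$⟩ʳ : ∀ i → pos π (π ⟨$⟩ʳ i) ≡ toℕ i
  pos-⟨$⟩ʳ i = cong toℕ (inverseˡ π)

  schedule-sorted : AllPairs _≺_ (map (π ⟨$⟩ʳ_) (allFin n))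
  schedule-sorted = AllPairs.map⁺ (AllPairs.tabulate⁺-< λ {i} {j} i<j →
    subst₂ ℕ._<_ (sym (pos-⟨$⟩ʳ i)) (sym (pos-⟨$⟩ʳ j)) i<j)

  degBefore≤deg : ∀ (E : Adjacency n) v → degBefore E π v ≤ deg E v
  degBefore≤deg E v = countᵇ-mono (λ u → proj₁ ∘ Equivalence.to T-∧) (allFin n)

module Processing {n : ℕ} (Δ : ℕ) (E : Adjacency n) (fuel : ℕ) (v : Fin n) where

  open Rationals
  open Distributions
  open ColourClasses using (conflicts; conflicts≤; totalClassSize≤n)
  open ColourSampling Δ E
    using (tryColour-nonNeg; tryColour-subProbability; queries; queryBound; 𝔼-queries≤)
  open import Data.Bool using (if_then_else_; T)
  open import Data.Nat as ℕ using (suc; _∸_; _<ᵇ_)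
  open import Data.Nat.Properties as ℕ using (<⇒<ᵇ)
  open import Data.Integer using (+_)
  open import Data.Rational using (ℚ; _+_; _≤_; _/_)
  open import Data.Rational.Properties using (≤-reflexive; ≤-trans; +-identityˡ; module ≤-Reasoning)
  open import Data.Fin using (_≟_)
  open import Data.List using (List; []; _∷_)
  open import Data.List.Relation.Unary.All as All using (All; []; _∷_)
  open import Data.List.Relation.Unary.AllPairs using (AllPairs; []; _∷_)
  open import Data.Maybe using (is-just; nothing)
  open import Data.Product using (_×_; _,_; proj₂)
  open import Function using (_∘_)
  open import Relation.Nullary using (yes; no)
  open import Relation.Nullary.Decidable using (⌊_⌋; dec-yes; dec-no)
  open import Relation.Binary.PropositionalEquality

  -- process Δ E fuel v (u ∷ us) col xv unfolds to tryColour Δ E fuel col u 0 >>= next u us col xv.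
  next : Fin n → List (Fin n) → Colouring n Δ → ℕ → Fin (suc Δ) × ℕ → Dist ℕ
  next u us col xv (c , q) = process Δ E fuel v us (update col u c) (if ⌊ u ≟ v ⌋ then q else xv)

  frozen-after-v : ∀ {us} → All (_≢ v) us → ∀ col xv → 𝔼 fromℕ (process Δ E fuel v us col xv) ≤ fromℕ xv
  frozen-after-v []                 col xv = ≤-reflexive (𝔼-return fromℕ xv)
  frozen-after-v {u ∷ us} (u≢v ∷ us≢v) col xv =
    >>=-bounded (fromℕ xv) (tryColour-subProbability col u fuel 0) (fromℕ-nonNeg xv) continue
    where
    continue : ∀ cq → 𝔼 fromℕ (next u us col xv cq) ≤ fromℕ xv
    continue (c , q) rewrite dec-no (u ≟ v) u≢v = frozen-after-v us≢v (update col u c) xv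

  module _ (π : Permutation′ n) where

    open Schedule π using (_≺_; schedule-sorted)

    ColouredBefore : Colouring n Δ → Set
    ColouredBefore col = ∀ u → T (is-just (col u)) → T (pos π u <ᵇ pos π v)

    update-ColouredBefore : ∀ {col u} c → u ≺ v → ColouredBefore col → ColouredBefore (update col u c)
    update-ColouredBefore {col} {u} c u≺v before w with w ≟ u
    ... | yes refl = λ _ → <⇒<ᵇ u≺v
    ... | no _     = before w

    after-v⇒≢v : ∀ {w} → v ≺ w → w ≢ v
    after-v⇒≢v v≺w refl = ℕ.<-irrefl refl v≺w

    module _ (E-sym : ∀ u w → E u w ≡ E w u) (d≤Δ : degBefore E π v ℕ.≤ Δ) where

      private
        d = degBefore E π v

      bound : ℚ
      bound = + n / suc (Δ ∸ d)

      few-conflicts : ∀ col → ColouredBefore col → conflicts col E v ℕ.+ suc (Δ ∸ d) ℕ.≤ suc Δ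
      few-conflicts col before = begin
        conflicts col E v ℕ.+ suc (Δ ∸ d)
          ≤⟨ ℕ.+-monoˡ-≤ (suc (Δ ∸ d)) (conflicts≤ col E v E-sym _ before) ⟩
        d ℕ.+ suc (Δ ∸ d)                  ≡⟨ ℕ.+-suc d (Δ ∸ d) ⟩
        suc (d ℕ.+ (Δ ∸ d))                ≡⟨ cong suc (ℕ.m+[n∸m]≡n d≤Δ) ⟩
        suc Δ                              ∎
        where open ℕ.≤-Reasoning

      colouring-v : ∀ {us} → All (_≢ v) us → ∀ col xv → ColouredBefore col →
                    𝔼 fromℕ (process Δ E fuel v (v ∷ us) col xv) ≤ bound
      colouring-v {us} us≢v col xv before = begin
        𝔼 fromℕ (process Δ E fuel v (v ∷ us) col xv)
          ≤⟨ >>=-mono (tryColour-nonNeg col v fuel 0) continue ⟩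
        𝔼 (queries col v) (tryColour Δ E fuel col v 0)
          ≤⟨ 𝔼-queries≤ col v (Δ ∸ d) (few-conflicts col before) fuel 0 ⟩
        fromℕ 0 + queryBound col v (Δ ∸ d)  ≡⟨ +-identityˡ (queryBound col v (Δ ∸ d)) ⟩
        queryBound col v (Δ ∸ d)            ≤⟨ /-monoˡ-≤ (Δ ∸ d) (totalClassSize≤n col) ⟩
        bound                               ∎
        where
        open ≤-Reasoning
        continue : ∀ cq → 𝔼 fromℕ (next v us col xv cq) ≤ queries col v cq
        continue (c , q) rewrite proj₂ (dec-yes (v ≟ v) refl) = frozen-after-v us≢v (update col v c) q

      process-≤ : ∀ {us} → AllPairs _≺_ us → ∀ col xv → ColouredBefore col → fromℕ xv ≤ bound →
                  𝔼 fromℕ (process Δ E fuel v us col xv) ≤ bound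
      process-≤ [] col xv before xv≤bound = ≤-trans (≤-reflexive (𝔼-return fromℕ xv)) xv≤bound
      process-≤ {u ∷ us} (u≺us ∷ sorted) col xv before xv≤bound with u ≟ v
      ... | yes refl = colouring-v (All.map after-v⇒≢v u≺us) col xv before
      ... | no u≢v with pos π u ℕ.<? pos π v
      ...   | yes u≺v =
        >>=-bounded bound (tryColour-subProbability col u fuel 0) (/-nonNeg n (Δ ∸ d)) continue
        where
        continue : ∀ cq → 𝔼 fromℕ (next u us col xv cq) ≤ bound
        continue (c , q) rewrite dec-no (u ≟ v) u≢v =
          process-≤ sorted (update col u c) xv (update-ColouredBefore c u≺v before) xv≤bound
      ...   | no u⊀v =
        ≤-trans (frozen-after-v (u≢v ∷ All.map (after-v⇒≢v ∘ ℕ.≤-<-trans (ℕ.≮⇒≥ u⊀v)) u≺us) col xv)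
                xv≤bound

      Xdist-≤ : 𝔼 fromℕ (Xdist Δ E π v fuel) ≤ bound
      Xdist-≤ = process-≤ schedule-sorted (λ _ → nothing) 0 (λ _ ()) (/-nonNeg n (Δ ∸ d))

open import Data.Bool using (false)
open import Data.Nat using (suc; _≤_; _∸_)
open import Data.Nat.Properties using (≤-trans)
open import Data.Integer using (+_)
open import Data.Rational using (_/_) renaming (_≤_ to _≤ℚ_)
open import Data.Product using (∃)
open import Relation.Binary.PropositionalEquality using (_≡_; sym; subst)

lemmaA4 : (n Δ : ℕ) (E : Adjacency n) →
    (∀ u w → E u w ≡ E w u) → (∀ u → E u u ≡ false) →
    (∀ u → deg E u ≤ Δ) → (∃ λ u → deg E u ≡ Δ) →
    (π : Permutation′ n) (v : Fin n) (fuel : ℕ) →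
    truncatedExpectedQueries Δ E π v fuel ≤ℚ (+ n / suc (Δ ∸ degBefore E π v))
lemmaA4 n Δ E E-sym _ deg≤Δ _ π v fuel =
  subst (_≤ℚ + n / suc (Δ ∸ degBefore E π v))
        (sym (Distributions.expectation≡𝔼 (Xdist Δ E π v fuel)))
        (Processing.Xdist-≤ Δ E fuel v π E-sym (≤-trans (Schedule.degBefore≤deg π E v) (deg≤Δ v)))
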